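{- Let $x,y$ be coprime positive integers with $x,y>1$, and let $\ell,m$ be integers with $\ell\ge x$ and $m\ge y$. Put $F=(x-1)(y-1)$ and $S=\ell y+mx$. Then every integer $N$ with $F\le N\le S-F$ can be written as $N=\alpha y+\beta x$ with integers $0\le\alpha\le\ell$ and $0\le\beta\le m$. -}

module Defs where

-- Bézout and division by x give N = α y + β x with α < x, and N ≥ (x - 1)(y - 1) forces β ≥ 0.
-- If β > m, trading copies of x for copies of y brings β into the window (m - y, m]; then
-- N + (x - 1)(y - 1) ≤ ℓ y + m x leaves no room for α > ℓ.
module Submission where

open import Defs
open import Data.Nat using (ℕ; suc; s≤s⁻¹; _+_; _*_; _∸_; _≤_; _<_; _≤?_; _%_; _/_; NonZero)
open import Data.Nat.Properties
open import Data.Nat.DivMod using (m≡m%n+[m/n]*n; m%n<n)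
open import Data.Nat.Coprimality using (Coprime; coprime-Bézout)
open import Data.Nat.GCD using (module Bézout)
open import Data.Nat.Tactic.RingSolver using (solve-∀)
open import Data.Product using (Σ; _×_; _,_; ∃-syntax)
open import Relation.Nullary using (yes; no)
open import Relation.Binary.PropositionalEquality

private
  variable
    x y ℓ m N α β s r : ℕ

bezout-unit : .{{_ : NonZero x}} → Coprime x y → ∃[ s ] ∃[ t ] ∃[ r ] 1 + s * x ≡ t * y + r * x
bezout-unit {x = suc x′} {y} coprime with coprime-Bézout coprime
... | Bézout.-+ a b 1+ax≡by = a , b , 0 , trans 1+ax≡by (sym (+-identityʳ (b * y)))
... | Bézout.+- a b 1+by≡ax = x′ * a , x′ * b , 1 , (begin
  1 + x′ * a * suc x′      ≡⟨ cong (1 +_) (*-assoc x′ a (suc x′)) ⟩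
  1 + x′ * (a * suc x′)    ≡⟨ cong (λ z → 1 + x′ * z) (sym 1+by≡ax) ⟩
  1 + x′ * (1 + b * y)     ≡⟨ expand x′ b y ⟩
  x′ * b * y + 1 * suc x′  ∎)
  where
  open ≡-Reasoning
  expand : ∀ x′ b y → 1 + x′ * (1 + b * y) ≡ x′ * b * y + 1 * suc x′
  expand = solve-∀

bezout-combination : .{{_ : NonZero x}} → Coprime x y →
                     ∀ N → ∃[ s ] ∃[ t ] ∃[ r ] N + s * x ≡ t * y + r * x
bezout-combination {x} {y} coprime N with bezout-unit coprime
... | s , t , r , eq = N * s , N * t , N * r , (begin
  N + N * s * x          ≡⟨ factor N s x ⟩
  N * (1 + s * x)        ≡⟨ cong (N *_) eq ⟩
  N * (t * y + r * x)    ≡⟨ distribute N t y r x ⟩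
  N * t * y + N * r * x  ∎)
  where
  open ≡-Reasoning
  factor : ∀ N s x → N + N * s * x ≡ N * (1 + s * x)
  factor = solve-∀
  distribute : ∀ N t y r x → N * (t * y + r * x) ≡ N * t * y + N * r * x
  distribute = solve-∀

divmod-coefficient : .{{_ : NonZero x}} → ∀ t r → t * y + r * x ≡ t % x * y + (t / x * y + r) * x
divmod-coefficient {x} {y} t r = begin
  t * y + r * x                     ≡⟨ cong (λ z → z * y + r * x) (m≡m%n+[m/n]*n t x) ⟩
  (t % x + t / x * x) * y + r * x   ≡⟨ regroup (t % x) (t / x) x y r ⟩
  t % x * y + (t / x * y + r) * x   ∎
  where
  open ≡-Reasoning
  regroup : ∀ a q x y r → (a + q * x) * y + r * x ≡ a * y + (q * y + r) * x
  regroup = solve-∀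

-- If r < s then N + x ≤ α y ≤ (x - 1) y, which is less than (x - 1)(y - 1) + x.
nonneg-coefficient : .{{_ : NonZero x}} → .{{_ : NonZero y}} → ∀ s r →
                     (x ∸ 1) * (y ∸ 1) ≤ N → α < x → N + s * x ≡ α * y + r * x → s ≤ r
nonneg-coefficient {x = suc x′} {y = suc y′} {N} {α} s r F≤N α<x eq =
  ≮⇒≥ λ r<s → <-irrefl refl (begin-strict
    N + suc x′             ≤⟨ +-cancelʳ-≤ (r * suc x′) (N + suc x′) (α * suc y′) (gap r<s) ⟩
    α * suc y′             ≤⟨ *-monoˡ-≤ (suc y′) (s≤s⁻¹ α<x) ⟩
    x′ * suc y′            ≡⟨ trans (*-suc x′ y′) (+-comm x′ (x′ * y′)) ⟩
    x′ * y′ + x′           <⟨ +-monoʳ-< (x′ * y′) (n<1+n x′) ⟩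
    x′ * y′ + suc x′       ≤⟨ +-monoˡ-≤ (suc x′) F≤N ⟩
    N + suc x′             ∎)
  where
  open ≤-Reasoning
  gap : r < s → N + suc x′ + r * suc x′ ≤ α * suc y′ + r * suc x′
  gap r<s = begin
    N + suc x′ + r * suc x′  ≡⟨ +-assoc N (suc x′) (r * suc x′) ⟩
    N + suc r * suc x′       ≤⟨ +-monoʳ-≤ N (*-monoˡ-≤ (suc x′) r<s) ⟩
    N + s * suc x′           ≡⟨ eq ⟩
    α * suc y′ + r * suc x′  ∎

cancel-multiple : ∀ u → s ≤ r → N + s * x ≡ u + r * x → N ≡ u + (r ∸ s) * x
cancel-multiple {s} {r} {N} {x} u s≤r eq = begin
  N                        ≡⟨ m+n∸n≡m N (s * x) ⟨
  N + s * x ∸ s * x        ≡⟨ cong (_∸ s * x) eq ⟩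
  u + r * x ∸ s * x        ≡⟨ +-∸-assoc u (*-monoˡ-≤ x s≤r) ⟩
  u + (r * x ∸ s * x)      ≡⟨ cong (u +_) (*-distribʳ-∸ x r s) ⟨
  u + (r ∸ s) * x          ∎
  where open ≡-Reasoning

frobenius-representation : .{{_ : NonZero x}} → .{{_ : NonZero y}} → Coprime x y →
                           (x ∸ 1) * (y ∸ 1) ≤ N → ∃[ α ] ∃[ β ] α < x × N ≡ α * y + β * x
frobenius-representation {x} {y} {N} coprime F≤N with bezout-combination coprime N
... | s , t , r , eq = t % x , R ∸ s , α<x , cancel-multiple (t % x * y) s≤R eq′
  where
  α<x : t % x < x
  α<x = m%n<n t x
  R = t / x * y + r
  eq′ : N + s * x ≡ t % x * y + R * x
  eq′ = trans eq (divmod-coefficient t r)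
  s≤R : s ≤ R
  s≤R = nonneg-coefficient s R F≤N α<x eq′

reduce-into-window : .{{_ : NonZero y}} → y ∸ 1 ≤ m → m < β →
                     ∃[ k ] ∃[ β′ ] β ≡ k * y + β′ × β′ ≤ m × m < β′ + y
reduce-into-window {y = suc y′} {m} {β} y′≤m m<β = e / suc y′ , c + e % suc y′ , β≡ , β′≤m , m<β′+y
  where
  c = m ∸ y′
  e = β ∸ c
  c+y′≡m : c + y′ ≡ m
  c+y′≡m = m∸n+n≡m y′≤m
  e%y≤y′ : e % suc y′ ≤ y′
  e%y≤y′ = s≤s⁻¹ (m%n<n e (suc y′))
  β≡ : β ≡ e / suc y′ * suc y′ + (c + e % suc y′)
  β≡ = begin
    β                                    ≡⟨ m∸n+n≡m (≤-trans (m∸n≤m m y′) (<⇒≤ m<β)) ⟨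
    e + c                                ≡⟨ cong (_+ c) (m≡m%n+[m/n]*n e (suc y′)) ⟩
    e % suc y′ + e / suc y′ * suc y′ + c ≡⟨ regroup (e % suc y′) (e / suc y′ * suc y′) c ⟩
    e / suc y′ * suc y′ + (c + e % suc y′) ∎
    where
    open ≡-Reasoning
    regroup : ∀ a b c → a + b + c ≡ b + (c + a)
    regroup = solve-∀
  β′≤m : c + e % suc y′ ≤ m
  β′≤m = subst (c + e % suc y′ ≤_) c+y′≡m (+-monoʳ-≤ c e%y≤y′)
  m<β′+y : m < c + e % suc y′ + suc y′
  m<β′+y = subst (_< c + e % suc y′ + suc y′) c+y′≡m
             (+-mono-≤-< (m≤m+n c (e % suc y′)) (n<1+n y′))

-- If ℓ < α then (ℓ + 1) y + (m + 1) x ≤ α y + (β + y) x = N + x y,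
-- which exceeds N + (x - 1)(y - 1) by only x + y - 1.
coefficient-bound : .{{_ : NonZero x}} → .{{_ : NonZero y}} → N ≡ α * y + β * x → m < β + y →
                    N + (x ∸ 1) * (y ∸ 1) ≤ ℓ * y + m * x → α ≤ ℓ
coefficient-bound {x = suc x′} {y = suc y′} {N} {α} {β} {m} {ℓ} N≡ m<β+y N+F≤S =
  ≮⇒≥ λ ℓ<α → <-irrefl refl (begin-strict
    S + suc x′ + y′                     <⟨ +-monoʳ-< (S + suc x′) (n<1+n y′) ⟩
    S + suc x′ + suc y′                 ≡⟨ collect ℓ m x′ y′ ⟩
    suc ℓ * suc y′ + suc m * suc x′     ≤⟨ +-mono-≤ (*-monoˡ-≤ (suc y′) ℓ<α) (*-monoˡ-≤ (suc x′) m<β+y) ⟩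
    α * suc y′ + (β + suc y′) * suc x′  ≡⟨ expand α β x′ y′ ⟩
    α * suc y′ + β * suc x′ + suc x′ * suc y′  ≡⟨ cong (_+ suc x′ * suc y′) N≡ ⟨
    N + suc x′ * suc y′                 ≡⟨ split N x′ y′ ⟩
    N + x′ * y′ + suc x′ + y′           ≤⟨ +-monoˡ-≤ y′ (+-monoˡ-≤ (suc x′) N+F≤S) ⟩
    S + suc x′ + y′                     ∎)
  where
  S = ℓ * suc y′ + m * suc x′
  open ≤-Reasoning
  collect : ∀ ℓ m x′ y′ → ℓ * suc y′ + m * suc x′ + suc x′ + suc y′ ≡ suc ℓ * suc y′ + suc m * suc x′
  collect = solve-∀
  expand : ∀ α β x′ y′ → α * suc y′ + (β + suc y′) * suc x′ ≡ α * suc y′ + β * suc x′ + suc x′ * suc y′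
  expand = solve-∀
  split : ∀ N x′ y′ → N + suc x′ * suc y′ ≡ N + x′ * y′ + suc x′ + y′
  split = solve-∀

bounded-representation : .{{_ : NonZero x}} → .{{_ : NonZero y}} → x ≤ ℓ → y ∸ 1 ≤ m →
                         N + (x ∸ 1) * (y ∸ 1) ≤ ℓ * y + m * x → α < x → N ≡ α * y + β * x →
                         ∃[ α ] ∃[ β ] α ≤ ℓ × β ≤ m × N ≡ α * y + β * x
bounded-representation {x} {y} {ℓ} {m} {N} {α} {β} x≤ℓ y∸1≤m N+F≤S α<x N≡αy+βx with β ≤? m
... | yes β≤m = α , β , <⇒≤ (<-≤-trans α<x x≤ℓ) , β≤m , N≡αy+βx
... | no β≰m with reduce-into-window y∸1≤m (≰⇒> β≰m)
...   | k , β′ , β≡ky+β′ , β′≤m , m<β′+y =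
  α + k * x , β′ , coefficient-bound N≡ m<β′+y N+F≤S , β′≤m , N≡
  where
  N≡ : N ≡ (α + k * x) * y + β′ * x
  N≡ = trans N≡αy+βx (trans (cong (λ b → α * y + b * x) β≡ky+β′) (exchange α β′ k x y))
    where
    exchange : ∀ α β′ k x y → α * y + (k * y + β′) * x ≡ (α + k * x) * y + β′ * x
    exchange = solve-∀

lemma2 : (x y ℓ m : ℕ) → Coprime x y → 1 < x → 1 < y → x ≤ ℓ → y ≤ m →
    (N : ℕ) → (x ∸ 1) * (y ∸ 1) ≤ N → N + (x ∸ 1) * (y ∸ 1) ≤ ℓ * y + m * x →
    Σ ℕ (λ α → Σ ℕ (λ β → α ≤ ℓ × β ≤ m × N ≡ α * y + β * x))
-- The theorem holds for x, y ≥ 1; the hypotheses 1 < x and 1 < y only exclude x = 0 and y = 0.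
lemma2 (suc x′) (suc y′) ℓ m coprime _ _ x≤ℓ y≤m N F≤N N+F≤S =
  let α , β , α<x , N≡αy+βx = frobenius-representation coprime F≤N
  in  bounded-representation {α = α} {β = β} x≤ℓ (<⇒≤ y≤m) N+F≤S α<x N≡αy+βx
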